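{- Let $A,B_1,\ldots,B_k\in\mathsf{ASM}(n)$ with $A=B_1\vee\cdots\vee B_k$, and let $i\in[n-1]$. Then $\pi_i(A)=\pi_i(B_1)\vee\cdots\vee\pi_i(B_k)$. Equivalently, if $I_A=\sum_{j=1}^k I_{B_j}$, then $I_{\pi_i(A)}=\sum_{j=1}^k I_{\pi_i(B_j)}$.
   Context: An $n\times n$ alternating sign matrix (ASM) is a matrix with entries in $\{ -1,0,1\}$ whose nonzero entries in each row and each column alternate in sign and sum to $1$; $\mathsf{ASM}(n)$ is the set of these. The corner sum function is $\mathrm{rk}_A(i,j)=\sum_{a\le i,\,b\le j}A_{a,b}$. Strong order: $A\le B$ iff $\mathrm{rk}_A(i,j)\ge\mathrm{rk}_B(i,j)$ for all $i,j\in[n]$; this makes $\mathsf{ASM}(n)$ a lattice with join $\vee$. Over a field $\kappa$, with $S=\kappa[z_{i,j}:i,j\in[n]]$ and $Z=(z_{i,j})$, the ASM ideal is $I_A=\sum_{i,j}I_{\mathrm{rk}_A(i,j)+1}(Z_{[i],[j]})$, where $I_k(Z_{[i],[j]})$ is generated by the $k$-minors of the upper-left $i\times j$ submatrix. For $i\in[n-1]$, $\pi_i(A)$ is the strong-order minimum of $\{B\in\mathsf{ASM}(n):\mathrm{rk}_B(a,b)=\mathrm{rk}_A(a,b)\text{ for all }a\neq i\}$. -}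

module Defs where

open import Data.Nat using (ℕ; suc; _<_; _∸_)
open import Data.Nat.Properties using () renaming (_≤?_ to _≤ℕ?_)
open import Data.Integer using (ℤ; 0ℤ; 1ℤ; -1ℤ; _*_; _+_; _≤_; _≟_)
open import Data.Fin using (Fin; toℕ)
open import Data.List using (List; []; _∷_; map; filter; foldr; allFin)
open import Data.Unit using (⊤)
open import Data.Sum using (_⊎_)
open import Data.Product using (_×_)
open import Relation.Nullary using (¬_; ¬?)
open import Relation.Binary.PropositionalEquality using (_≡_; _≢_)

-- n × n integer matrices, 0-based indices (row a, column b)
Matrix : ℕ → Set
Matrix n = Fin n → Fin n → ℤ

rowList : ∀ {n} → Matrix n → Fin n → List ℤ
rowList {n} A a = map (λ b → A a b) (allFin n)

colList : ∀ {n} → Matrix n → Fin n → List ℤ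
colList {n} A b = map (λ a → A a b) (allFin n)

sum : List ℤ → ℤ
sum = foldr _+_ 0ℤ

nonzeros : List ℤ → List ℤ
nonzeros = filter (λ x → ¬? (x ≟ 0ℤ))

-- consecutive elements alternate in sign (entries are ±1 here, so product = -1)
Alternating : List ℤ → Set
Alternating []            = ⊤
Alternating (x ∷ [])      = ⊤
Alternating (x ∷ y ∷ xs)  = (x * y ≡ -1ℤ) × Alternating (y ∷ xs)

GoodLine : List ℤ → Set
GoodLine xs = Alternating (nonzeros xs) × (sum xs ≡ 1ℤ)

IsASM : ∀ {n} → Matrix n → Set
IsASM {n} A =
  (∀ a b → (A a b ≡ -1ℤ) ⊎ ((A a b ≡ 0ℤ) ⊎ (A a b ≡ 1ℤ))) ×
  (∀ a → GoodLine (rowList A a)) ×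
  (∀ b → GoodLine (colList A b))

rk : ∀ {n} → Matrix n → Fin n → Fin n → ℤ
rk {n} A i j =
  sum (map (λ a → sum (map (λ b → A a b)
                           (filter (λ b → toℕ b ≤ℕ? toℕ j) (allFin n))))
           (filter (λ a → toℕ a ≤ℕ? toℕ i) (allFin n)))

_≤ₛ_ : ∀ {n} → Matrix n → Matrix n → Set
A ≤ₛ B = ∀ i j → rk B i j ≤ rk A i j

IsJoin : ∀ {n k} → (Fin k → Matrix n) → Matrix n → Set
IsJoin {n} B J =
  IsASM J × (∀ t → B t ≤ₛ J) ×
  (∀ (C : Matrix n) → IsASM C → (∀ t → B t ≤ₛ C) → J ≤ₛ C)

SameRkOffRow : ∀ {n} → Fin n → Matrix n → Matrix n → Set
SameRkOffRow {n} i A B = IsASM B × (∀ (a : Fin n) → a ≢ i → ∀ b → rk B a b ≡ rk A a b)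

IsPi : ∀ {n} → Fin n → Matrix n → Matrix n → Set
IsPi {n} i A P = SameRkOffRow i A P × (∀ (C : Matrix n) → SameRkOffRow i A C → P ≤ₛ C)

-- An ASM is determined by its corner sums, and the strong order is the reverse pointwise order
-- on them.  The corner-sum functions are exactly the functions on the grid {0,…,n}² with fixed
-- boundary values that grow by 0 or 1 along every row and column (Robbins–Rumsey); this class is
-- closed under pointwise minima, so the join of B₁,…,B_k has the pointwise minimum of their corner
-- sums.  π_i keeps every row of corner sums except row i, which becomes min(rk(i-1,·)+1, rk(i+1,·)),
-- the largest value allowed by the unit steps.  Since x ↦ x + 1 is monotone and ⊓ is associative
-- and commutative, this operation commutes with pointwise minima, which is the proposition.

module Submission where

open import Defs
open import Data.Nat using (ℕ; _<_; _∸_; _≤_)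
open import Data.Fin using (Fin; toℕ)

open import Data.Nat as ℕ using (zero; suc; z≤n; s≤s)
import Data.Nat.Properties as ℕP
open import Data.Integer as ℤ using (ℤ; +_; 0ℤ; 1ℤ; -1ℤ; _+_; _-_; _⊓_) renaming (_≤_ to _≤ℤ_)
import Data.Integer.Properties as ℤP
open import Data.Integer.Tactic.RingSolver using (solve-∀)
open import Data.Fin as Fin using (fromℕ<)
import Data.Fin.Properties as FinP
open import Data.List using (List; []; _∷_; map; filter; allFin; tabulate; take; length)
import Data.List.Properties as ListP
open import Data.Bool using (if_then_else_; true; false)
open import Data.Sum using (_⊎_; inj₁; inj₂)
open import Data.Product using (_×_; _,_; proj₁; proj₂)
open import Relation.Nullary using (yes; no; does; contradiction)
open import Relation.Nullary.Decidable using (dec-true; dec-false)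
open import Relation.Unary using (Pred; Decidable)
open import Relation.Binary.PropositionalEquality
open import Function using (_∘_; id)
import Algebra.Properties.CommutativeSemigroup as CommSemigroupProperties
open import Data.List.Relation.Unary.All as All using (All; []; _∷_)
import Data.List.Relation.Unary.All.Properties as AllP
open import Data.Unit using (tt)

-- Corner sums

sumBelow : (ℕ → ℤ) → ℕ → ℤ
sumBelow f zero    = 0ℤ
sumBelow f (suc m) = sumBelow f m + f m

sumBelow-cong : ∀ {f g} m → (∀ x → x < m → f x ≡ g x) → sumBelow f m ≡ sumBelow g m
sumBelow-cong zero    f≗g = refl
sumBelow-cong (suc m) f≗g =
  cong₂ _+_ (sumBelow-cong m (λ x x<m → f≗g x (ℕP.m<n⇒m<1+n x<m))) (f≗g m ℕP.≤-refl)

sumBelow-zeros : ∀ m → sumBelow (λ _ → 0ℤ) m ≡ 0ℤ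
sumBelow-zeros zero    = refl
sumBelow-zeros (suc m) = trans (ℤP.+-identityʳ _) (sumBelow-zeros m)

sumBelow-sucˡ : ∀ (f : ℕ → ℤ) m → sumBelow f (suc m) ≡ f 0 + sumBelow (f ∘ suc) m
sumBelow-sucˡ f zero    = trans (ℤP.+-identityˡ (f 0)) (sym (ℤP.+-identityʳ (f 0)))
sumBelow-sucˡ f (suc m) =
  trans (cong (_+ f (suc m)) (sumBelow-sucˡ f m)) (ℤP.+-assoc (f 0) (sumBelow (f ∘ suc) m) (f (suc m)))

sumBelow-distrib-+ : ∀ (f g : ℕ → ℤ) m → sumBelow (λ x → f x + g x) m ≡ sumBelow f m + sumBelow g m
sumBelow-distrib-+ f g zero    = refl
sumBelow-distrib-+ f g (suc m) =
  trans (cong (_+ (f m + g m)) (sumBelow-distrib-+ f g m)) (interchange (sumBelow f m) (sumBelow g m) (f m) (g m))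
  where open CommSemigroupProperties ℤP.+-commutativeSemigroup using (interchange)

sumBelow-telescope : ∀ (g : ℕ → ℤ) m → sumBelow (λ y → g (suc y) - g y) m ≡ g m - g 0
sumBelow-telescope g zero    = sym (ℤP.+-inverseʳ (g 0))
sumBelow-telescope g (suc m) =
  trans (cong (_+ (g (suc m) - g m)) (sumBelow-telescope g m)) (chain (g 0) (g m) (g (suc m)))
  where
  chain : ∀ a b c → (b - a) + (c - b) ≡ c - a
  chain = solve-∀

sumBelow-if≤ : ∀ (f : ℕ → ℤ) j m → suc j ≤ m →
               sumBelow (λ y → if does (y ℕP.≤? j) then f y else 0ℤ) m ≡ sumBelow f (suc j)
sumBelow-if≤ f j m 1+j≤m = trans (dropped m 1+j≤m) (sumBelow-cong (suc j) kept)
  where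
  g : ℕ → ℤ
  g y = if does (y ℕP.≤? j) then f y else 0ℤ
  kept : ∀ y → y < suc j → g y ≡ f y
  kept y (s≤s y≤j) rewrite dec-true (y ℕP.≤? j) y≤j = refl
  dropped : ∀ m → suc j ≤ m → sumBelow g m ≡ sumBelow g (suc j)
  dropped (suc m) (s≤s j≤m) with j ℕP.≟ m
  ... | yes refl = refl
  ... | no j≢m rewrite dec-false (m ℕP.≤? j) (ℕP.<⇒≱ (ℕP.≤∧≢⇒< j≤m j≢m)) =
    trans (ℤP.+-identityʳ _) (dropped m (ℕP.≤∧≢⇒< j≤m j≢m))

sum-take-tabulate : ∀ {n} (g : Fin n → ℤ) {f : ℕ → ℤ} → (∀ b → g b ≡ f (toℕ b)) →
                    ∀ m → m ≤ n → sum (take m (tabulate g)) ≡ sumBelow f m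
sum-take-tabulate g             g≗f zero    _         = refl
sum-take-tabulate {suc n} g {f} g≗f (suc m) (s≤s m≤n) =
  trans (cong₂ _+_ (g≗f Fin.zero) (sum-take-tabulate (g ∘ Fin.suc) (g≗f ∘ Fin.suc) m m≤n))
        (sym (sumBelow-sucˡ f m))

sum-tabulate : ∀ {n} (g : Fin n → ℤ) {f : ℕ → ℤ} → (∀ b → g b ≡ f (toℕ b)) →
               sum (tabulate g) ≡ sumBelow f n
sum-tabulate {n} g g≗f =
  trans (cong sum (sym (ListP.take-all n (tabulate g) (ℕP.≤-reflexive (ListP.length-tabulate g)))))
        (sum-take-tabulate g g≗f n ℕP.≤-refl)

sum-map-filter : ∀ {a p} {A : Set a} {P : Pred A p} (P? : Decidable P) (g : A → ℤ) xs →
                 sum (map g (filter P? xs)) ≡ sum (map (λ x → if does (P? x) then g x else 0ℤ) xs)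
sum-map-filter P? g []       = refl
sum-map-filter P? g (x ∷ xs) with does (P? x)
... | true  = cong (λ s → g x + s) (sum-map-filter P? g xs)
... | false = trans (sum-map-filter P? g xs) (sym (ℤP.+-identityˡ _))

sum-filter-≤ : ∀ {n} (g : Fin n → ℤ) {f : ℕ → ℤ} → (∀ b → g b ≡ f (toℕ b)) → (j : Fin n) →
               sum (map g (filter (λ b → toℕ b ℕP.≤? toℕ j) (allFin n))) ≡ sumBelow f (suc (toℕ j))
sum-filter-≤ {n} g {f} g≗f j = begin
  sum (map g (filter (λ b → toℕ b ℕP.≤? toℕ j) (allFin n)))
    ≡⟨ sum-map-filter (λ b → toℕ b ℕP.≤? toℕ j) g (allFin n) ⟩
  sum (map (λ b → if does (toℕ b ℕP.≤? toℕ j) then g b else 0ℤ) (allFin n))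
    ≡⟨ cong sum (ListP.map-tabulate {n = n} id _) ⟩
  sum (tabulate (λ b → if does (toℕ b ℕP.≤? toℕ j) then g b else 0ℤ))
    ≡⟨ sum-tabulate _ (λ b → cong (λ v → if does (toℕ b ℕP.≤? toℕ j) then v else 0ℤ) (g≗f b)) ⟩
  sumBelow (λ y → if does (y ℕP.≤? toℕ j) then f y else 0ℤ) n
    ≡⟨ sumBelow-if≤ f (toℕ j) n (FinP.toℕ<n j) ⟩
  sumBelow f (suc (toℕ j)) ∎
  where open ≡-Reasoning

entry : ∀ {n} → Matrix n → ℕ → ℕ → ℤ
entry {n} M x y with x ℕP.<? n | y ℕP.<? n
... | yes x<n | yes y<n = M (fromℕ< x<n) (fromℕ< y<n)
... | _       | _       = 0ℤ

entry-fromℕ< : ∀ {n} (M : Matrix n) {x y} (x<n : x < n) (y<n : y < n) →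
               entry M x y ≡ M (fromℕ< x<n) (fromℕ< y<n)
entry-fromℕ< {n} M {x} {y} x<n y<n with x ℕP.<? n | y ℕP.<? n
... | yes _    | yes _    = refl
... | no x≮n   | _        = contradiction x<n x≮n
... | yes _    | no y≮n   = contradiction y<n y≮n

entry-toℕ : ∀ {n} (M : Matrix n) (a b : Fin n) → entry M (toℕ a) (toℕ b) ≡ M a b
entry-toℕ M a b = trans (entry-fromℕ< M (FinP.toℕ<n a) (FinP.toℕ<n b))
                        (cong₂ M (FinP.fromℕ<-toℕ a _) (FinP.fromℕ<-toℕ b _))

entry-row : ∀ {n} (M : Matrix n) {a} (a<n : a < n) (y : Fin n) → M (fromℕ< a<n) y ≡ entry M a (toℕ y)
entry-row M a<n y = sym (trans (entry-fromℕ< M a<n (FinP.toℕ<n y)) (cong (M _) (FinP.fromℕ<-toℕ y _)))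

entry-column : ∀ {n} (M : Matrix n) {b} (b<n : b < n) (x : Fin n) → M x (fromℕ< b<n) ≡ entry M (toℕ x) b
entry-column M b<n x = sym (trans (entry-fromℕ< M (FinP.toℕ<n x) b<n) (cong (λ a → M a _) (FinP.fromℕ<-toℕ x _)))

-- Indexed by the grid {0,…,n}²: row 0 and column 0 vanish and corner M (1+i) (1+j) = rk M i j.
corner : ∀ {n} → Matrix n → ℕ → ℕ → ℤ
corner M a b = sumBelow (λ x → sumBelow (entry M x) b) a

rk≡corner : ∀ {n} (M : Matrix n) (i j : Fin n) → rk M i j ≡ corner M (suc (toℕ i)) (suc (toℕ j))
rk≡corner M i j =
  sum-filter-≤ _ (λ a → sum-filter-≤ (M a) (λ b → sym (entry-toℕ M a b)) j) i

rk-fromℕ< : ∀ {n} (M : Matrix n) {a b} (a<n : a < n) (b<n : b < n) →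
            rk M (fromℕ< a<n) (fromℕ< b<n) ≡ corner M (suc a) (suc b)
rk-fromℕ< M a<n b<n =
  trans (rk≡corner M _ _)
        (cong₂ (λ x y → corner M (suc x) (suc y)) (FinP.toℕ-fromℕ< a<n) (FinP.toℕ-fromℕ< b<n))

corner-zeroʳ : ∀ {n} (M : Matrix n) a → corner M a 0 ≡ 0ℤ
corner-zeroʳ M = sumBelow-zeros

corner-suc-column : ∀ {n} (M : Matrix n) a b →
                    corner M a (suc b) ≡ corner M a b + sumBelow (λ x → entry M x b) a
corner-suc-column M a b = sumBelow-distrib-+ (λ x → sumBelow (entry M x) b) (λ x → entry M x b) a

-- Lines of alternating sign matrices

Bit : ℤ → Set
Bit z = (z ≡ 0ℤ) ⊎ (z ≡ 1ℤ)

NegBit : ℤ → Set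
NegBit z = (z ≡ 0ℤ) ⊎ (z ≡ -1ℤ)

Trit : ℤ → Set
Trit x = (x ≡ -1ℤ) ⊎ ((x ≡ 0ℤ) ⊎ (x ≡ 1ℤ))

bit-0+ : ∀ {s} → Bit s → Bit (0ℤ + s)
bit-0+ (inj₁ refl) = inj₁ refl
bit-0+ (inj₂ refl) = inj₂ refl

negBit-0+ : ∀ {s} → NegBit s → NegBit (0ℤ + s)
negBit-0+ (inj₁ refl) = inj₁ refl
negBit-0+ (inj₂ refl) = inj₂ refl

bit-−1+ : ∀ {s} → Bit s → NegBit (-1ℤ + s)
bit-−1+ (inj₁ refl) = inj₂ refl
bit-−1+ (inj₂ refl) = inj₁ refl

negBit-1+ : ∀ {s} → NegBit s → Bit (1ℤ + s)
negBit-1+ (inj₁ refl) = inj₂ refl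
negBit-1+ (inj₂ refl) = inj₁ refl

mutual
  prefixSum-afterPlus : ∀ {xs} → All Trit xs → Alternating (1ℤ ∷ nonzeros xs) → ∀ m → NegBit (sum (take m xs))
  prefixSum-afterPlus _                      _         zero    = inj₁ refl
  prefixSum-afterPlus []                     _         (suc m) = inj₁ refl
  prefixSum-afterPlus (inj₂ (inj₁ refl) ∷ ts) alt       (suc m) = negBit-0+ (prefixSum-afterPlus ts alt m)
  prefixSum-afterPlus (inj₂ (inj₂ refl) ∷ ts) (() , _)  (suc m)
  prefixSum-afterPlus (inj₁ refl ∷ ts)        (_ , alt) (suc m) = bit-−1+ (prefixSum-afterMinus ts alt m)

  prefixSum-afterMinus : ∀ {xs} → All Trit xs → Alternating (-1ℤ ∷ nonzeros xs) → ∀ m → Bit (sum (take m xs))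
  prefixSum-afterMinus _                      _         zero    = inj₁ refl
  prefixSum-afterMinus []                     _         (suc m) = inj₁ refl
  prefixSum-afterMinus (inj₂ (inj₁ refl) ∷ ts) alt       (suc m) = bit-0+ (prefixSum-afterMinus ts alt m)
  prefixSum-afterMinus (inj₁ refl ∷ ts)        (() , _)  (suc m)
  prefixSum-afterMinus (inj₂ (inj₂ refl) ∷ ts) (_ , alt) (suc m) = negBit-1+ (prefixSum-afterPlus ts alt m)

sum-take-length : ∀ xs → sum (take (length xs) xs) ≡ sum xs
sum-take-length xs = cong sum (ListP.take-all (length xs) xs ℕP.≤-refl)

prefixSum-goodLine : ∀ {xs} → All Trit xs → GoodLine xs → ∀ m → Bit (sum (take m xs))
prefixSum-goodLine _                      _              zero    = inj₁ refl
prefixSum-goodLine {x ∷ xs} (inj₂ (inj₁ refl) ∷ ts) (alt , sum≡1) (suc m) =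
  bit-0+ (prefixSum-goodLine ts (alt , trans (sym (ℤP.+-identityˡ _)) sum≡1) m)
prefixSum-goodLine (inj₂ (inj₂ refl) ∷ ts) (alt , _)     (suc m) = negBit-1+ (prefixSum-afterPlus ts alt m)
prefixSum-goodLine {x ∷ xs} (inj₁ refl ∷ ts) (alt , sum≡1) (suc m) =
  contradiction sum≡1 (impossible (subst Bit (sum-take-length xs) (prefixSum-afterMinus ts alt (length xs))))
  where
  impossible : ∀ {s} → Bit s → -1ℤ + s ≢ 1ℤ
  impossible (inj₁ refl) ()
  impossible (inj₂ refl) ()

differences : ∀ n → (ℕ → ℤ) → List ℤ
differences n d = tabulate {n = n} (λ y → d (suc (toℕ y)) - d (toℕ y))

sum-differences : ∀ n (d : ℕ → ℤ) → sum (differences n d) ≡ d n - d 0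
sum-differences n d =
  trans (sum-tabulate {n = n} _ {λ y → d (suc y) - d y} (λ _ → refl)) (sumBelow-telescope d n)

-- τ is the sign of the last nonzero difference, which a 0/1 sequence starting at 0 determines
-- from its current value.
LastSign : ℤ → ℤ → Set
LastSign z τ = (z ≡ 0ℤ × τ ≡ -1ℤ) ⊎ (z ≡ 1ℤ × τ ≡ 1ℤ)

alternating-differences : ∀ n (d : ℕ → ℤ) τ → (∀ y → y ≤ n → Bit (d y)) → LastSign (d 0) τ →
                          Alternating (τ ∷ nonzeros (differences n d))
alternating-differences zero    d τ bits last = tt
alternating-differences (suc n) d τ bits last =
  step (bits 0 z≤n) (bits 1 (s≤s z≤n)) last
    (λ τ′ → alternating-differences n (d ∘ suc) τ′ (λ y y≤n → bits (suc y) (s≤s y≤n)))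
  where
  step : ∀ {u v τ} {rest : List ℤ} → Bit u → Bit v → LastSign u τ →
         (∀ τ′ → LastSign v τ′ → Alternating (τ′ ∷ nonzeros rest)) →
         Alternating (τ ∷ nonzeros ((v - u) ∷ rest))
  step (inj₁ refl) (inj₁ refl) (inj₁ (_ , refl)) alt = alt -1ℤ (inj₁ (refl , refl))
  step (inj₁ refl) (inj₂ refl) (inj₁ (_ , refl)) alt = refl , alt 1ℤ (inj₂ (refl , refl))
  step (inj₂ refl) (inj₁ refl) (inj₂ (_ , refl)) alt = refl , alt -1ℤ (inj₁ (refl , refl))
  step (inj₂ refl) (inj₂ refl) (inj₂ (_ , refl)) alt = alt 1ℤ (inj₂ (refl , refl))
  step (inj₁ refl) _           (inj₂ (() , _))   alt
  step (inj₂ refl) _           (inj₁ (() , _))   alt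

alternating-tail : ∀ τ xs → Alternating (τ ∷ xs) → Alternating xs
alternating-tail τ []       _         = tt
alternating-tail τ (x ∷ xs) (_ , alt) = alt

goodLine-differences : ∀ n (d : ℕ → ℤ) → (∀ y → y ≤ n → Bit (d y)) → d 0 ≡ 0ℤ → d n ≡ 1ℤ →
                       GoodLine (differences n d)
goodLine-differences n d bits d0≡0 dn≡1 =
  alternating-tail -1ℤ _ (alternating-differences n d -1ℤ bits (inj₁ (d0≡0 , refl))) ,
  trans (sum-differences n d) (cong₂ _-_ dn≡1 d0≡0)

-- Corner-sum functions

UnitStep : ℤ → ℤ → Set
UnitStep x y = x ≤ℤ y × y ≤ℤ x + 1ℤ

unitStep-bit : ∀ x {s} → Bit s → UnitStep x (x + s)
unitStep-bit x (inj₁ refl) = ℤP.≤-reflexive (sym (ℤP.+-identityʳ x)) , ℤP.+-monoʳ-≤ x (ℤ.+≤+ z≤n)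
unitStep-bit x (inj₂ refl) = ℤP.i≤i+j x 1ℤ , ℤP.≤-refl

record IsRankFunction (n : ℕ) (r : ℕ → ℕ → ℤ) : Set where
  field
    top    : ∀ b → b ≤ n → r 0 b ≡ 0ℤ
    left   : ∀ a → a ≤ n → r a 0 ≡ 0ℤ
    bottom : ∀ b → b ≤ n → r n b ≡ + b
    right  : ∀ a → a ≤ n → r a n ≡ + a
    down   : ∀ a b → a < n → b ≤ n → UnitStep (r a b) (r (suc a) b)
    across : ∀ a b → a ≤ n → b < n → UnitStep (r a b) (r a (suc b))

module _ {n} {M : Matrix n} (asm : IsASM M) where
  private
    trits : ∀ a b → Trit (M a b)
    trits = proj₁ asm

    row≡tabulate : ∀ a → rowList M a ≡ tabulate (M a)
    row≡tabulate a = ListP.map-tabulate {n = n} id (M a)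

    column≡tabulate : ∀ b → colList M b ≡ tabulate (λ a → M a b)
    column≡tabulate b = ListP.map-tabulate {n = n} id (λ a → M a b)

    rowPrefix-bit : ∀ {a} b → a < n → b ≤ n → Bit (sumBelow (entry M a) b)
    rowPrefix-bit b a<n b≤n =
      subst Bit (trans (cong (sum ∘ take b) (row≡tabulate a′)) (sum-take-tabulate _ (entry-row M a<n) b b≤n))
        (prefixSum-goodLine (AllP.map⁺ (All.universal (trits a′) (allFin n))) (proj₁ (proj₂ asm) a′) b)
      where
      a′ : Fin n
      a′ = fromℕ< a<n

    columnPrefix-bit : ∀ a {b} → a ≤ n → b < n → Bit (sumBelow (λ x → entry M x b) a)
    columnPrefix-bit a a≤n b<n =
      subst Bit (trans (cong (sum ∘ take a) (column≡tabulate b′)) (sum-take-tabulate _ (entry-column M b<n) a a≤n))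
        (prefixSum-goodLine (AllP.map⁺ (All.universal (λ x → trits x b′) (allFin n))) (proj₂ (proj₂ asm) b′) a)
      where
      b′ : Fin n
      b′ = fromℕ< b<n

    row-sum : ∀ {a} → a < n → sumBelow (entry M a) n ≡ 1ℤ
    row-sum a<n =
      trans (sym (trans (cong sum (row≡tabulate a′)) (sum-tabulate _ (entry-row M a<n))))
            (proj₂ (proj₁ (proj₂ asm) a′))
      where
      a′ : Fin n
      a′ = fromℕ< a<n

    column-sum : ∀ {b} → b < n → sumBelow (λ x → entry M x b) n ≡ 1ℤ
    column-sum b<n =
      trans (sym (trans (cong sum (column≡tabulate b′)) (sum-tabulate _ (entry-column M b<n))))
            (proj₂ (proj₂ (proj₂ asm) b′))
      where
      b′ : Fin n
      b′ = fromℕ< b<n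

    corner-right : ∀ a → a ≤ n → corner M a n ≡ + a
    corner-right zero    _   = refl
    corner-right (suc a) a<n =
      trans (cong₂ _+_ (corner-right a (ℕP.<⇒≤ a<n)) (row-sum a<n)) (cong +_ (ℕP.+-comm a 1))

    corner-bottom : ∀ b → b ≤ n → corner M n b ≡ + b
    corner-bottom zero    _   = corner-zeroʳ M n
    corner-bottom (suc b) b<n =
      trans (corner-suc-column M n b)
            (trans (cong₂ _+_ (corner-bottom b (ℕP.<⇒≤ b<n)) (column-sum b<n)) (cong +_ (ℕP.+-comm b 1)))

  corner-isRankFunction : IsRankFunction n (corner M)
  corner-isRankFunction = record
    { top    = λ _ _ → refl
    ; left   = λ a _ → corner-zeroʳ M a
    ; bottom = corner-bottom
    ; right  = corner-right
    ; down   = λ a b a<n b≤n → unitStep-bit (corner M a b) (rowPrefix-bit b a<n b≤n)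
    ; across = λ a b a≤n b<n → subst (UnitStep (corner M a b)) (sym (corner-suc-column M a b))
                                     (unitStep-bit (corner M a b) (columnPrefix-bit a a≤n b<n))
    }

bit-fromBounds : ∀ {s} → 0ℤ ≤ℤ s → s ≤ℤ 1ℤ → Bit s
bit-fromBounds {+ zero}          _ _                    = inj₁ refl
bit-fromBounds {+ suc zero}      _ _                    = inj₂ refl
bit-fromBounds {+ suc (suc _)}   _ (ℤ.+≤+ (s≤s ()))
bit-fromBounds {ℤ.-[1+ _ ]}      () _

unitStep⇒bit : ∀ {x y} → UnitStep x y → Bit (y - x)
unitStep⇒bit {x} {y} (x≤y , y≤x+1) =
  bit-fromBounds (ℤP.i≤j⇒0≤j-i x≤y)
                 (ℤP.≤-trans (ℤP.+-monoˡ-≤ (ℤ.- x) y≤x+1) (ℤP.≤-reflexive (cancel x)))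
  where
  cancel : ∀ x → (x + 1ℤ) - x ≡ 1ℤ
  cancel = solve-∀

trit-bitDifference : ∀ {u v} → Bit u → Bit v → Trit (v - u)
trit-bitDifference (inj₁ refl) (inj₁ refl) = inj₂ (inj₁ refl)
trit-bitDifference (inj₁ refl) (inj₂ refl) = inj₂ (inj₂ refl)
trit-bitDifference (inj₂ refl) (inj₁ refl) = inj₁ refl
trit-bitDifference (inj₂ refl) (inj₂ refl) = inj₂ (inj₁ refl)

rowDifference : (ℕ → ℕ → ℤ) → ℕ → ℕ → ℤ
rowDifference r x y = r (suc x) y - r x y

columnDifference : (ℕ → ℕ → ℤ) → ℕ → ℕ → ℤ
columnDifference r x y = r x (suc y) - r x y

mixedDifference-comm : ∀ r x y → rowDifference r x (suc y) - rowDifference r x y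
                                 ≡ columnDifference r (suc x) y - columnDifference r x y
mixedDifference-comm r x y = swap (r (suc x) (suc y)) (r x (suc y)) (r (suc x) y) (r x y)
  where
  swap : ∀ a b c d → (a - b) - (c - d) ≡ (a - c) - (b - d)
  swap = solve-∀

ofRank : ∀ {n} → (ℕ → ℕ → ℤ) → Matrix n
ofRank r a b = rowDifference r (toℕ a) (suc (toℕ b)) - rowDifference r (toℕ a) (toℕ b)

suc-difference : ∀ k → + suc k - + k ≡ 1ℤ
suc-difference k = cancel (+ k)
  where
  cancel : ∀ x → (1ℤ + x) - x ≡ 1ℤ
  cancel = solve-∀

module _ {n} {r : ℕ → ℕ → ℤ} (rank : IsRankFunction n r) where
  open IsRankFunction rank

  private
    rowDifference-bit : ∀ x y → x < n → y ≤ n → Bit (rowDifference r x y)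
    rowDifference-bit x y x<n y≤n = unitStep⇒bit (down x y x<n y≤n)

    columnDifference-bit : ∀ x y → x ≤ n → y < n → Bit (columnDifference r x y)
    columnDifference-bit x y x≤n y<n = unitStep⇒bit (across x y x≤n y<n)

    rowDifference-first : ∀ x → x < n → rowDifference r x 0 ≡ 0ℤ
    rowDifference-first x x<n = cong₂ _-_ (left (suc x) x<n) (left x (ℕP.<⇒≤ x<n))

    rowDifference-last : ∀ x → x < n → rowDifference r x n ≡ 1ℤ
    rowDifference-last x x<n = trans (cong₂ _-_ (right (suc x) x<n) (right x (ℕP.<⇒≤ x<n))) (suc-difference x)

    columnDifference-first : ∀ y → y < n → columnDifference r 0 y ≡ 0ℤ
    columnDifference-first y y<n = cong₂ _-_ (top (suc y) y<n) (top y (ℕP.<⇒≤ y<n))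

    columnDifference-last : ∀ y → y < n → columnDifference r n y ≡ 1ℤ
    columnDifference-last y y<n = trans (cong₂ _-_ (bottom (suc y) y<n) (bottom y (ℕP.<⇒≤ y<n))) (suc-difference y)

  ofRank-isASM : IsASM (ofRank {n} r)
  ofRank-isASM = trits , goodRow , goodColumn
    where
    trits : ∀ a b → Trit (ofRank r a b)
    trits a b = trit-bitDifference (rowDifference-bit (toℕ a) (toℕ b) (FinP.toℕ<n a) (ℕP.<⇒≤ (FinP.toℕ<n b)))
                                   (rowDifference-bit (toℕ a) (suc (toℕ b)) (FinP.toℕ<n a) (FinP.toℕ<n b))
    goodRow : ∀ a → GoodLine (rowList (ofRank {n} r) a)
    goodRow a =
      subst GoodLine (sym (ListP.map-tabulate {n = n} id (ofRank r a)))
        (goodLine-differences n (rowDifference r x) (λ y → rowDifference-bit x y x<n)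
                              (rowDifference-first x x<n) (rowDifference-last x x<n))
      where
      x : ℕ
      x = toℕ a
      x<n : x < n
      x<n = FinP.toℕ<n a
    goodColumn : ∀ b → GoodLine (colList (ofRank {n} r) b)
    goodColumn b =
      subst GoodLine (sym (trans (ListP.map-tabulate {n = n} id (λ a → ofRank r a b))
                                 (ListP.tabulate-cong (λ a → mixedDifference-comm r (toℕ a) y))))
        (goodLine-differences n (λ x → columnDifference r x y) (λ x x≤n → columnDifference-bit x y x≤n y<n)
                              (columnDifference-first y y<n) (columnDifference-last y y<n))
      where
      y : ℕ
      y = toℕ b
      y<n : y < n
      y<n = FinP.toℕ<n b

  private
    entry-ofRank : ∀ {x y} (x<n : x < n) (y<n : y < n) →
                   entry (ofRank {n} r) x y ≡ rowDifference r x (suc y) - rowDifference r x y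
    entry-ofRank x<n y<n =
      trans (entry-fromℕ< (ofRank {n} r) x<n y<n)
            (cong₂ (λ x y → rowDifference r x (suc y) - rowDifference r x y)
                   (FinP.toℕ-fromℕ< x<n) (FinP.toℕ-fromℕ< y<n))

    rowPrefix-ofRank : ∀ x b → x < n → b ≤ n → sumBelow (entry (ofRank {n} r) x) b ≡ rowDifference r x b
    rowPrefix-ofRank x b x<n b≤n = begin
      sumBelow (entry (ofRank {n} r) x) b
        ≡⟨ sumBelow-cong b (λ y y<b → entry-ofRank x<n (ℕP.<-≤-trans y<b b≤n)) ⟩
      sumBelow (λ y → rowDifference r x (suc y) - rowDifference r x y) b
        ≡⟨ sumBelow-telescope (rowDifference r x) b ⟩
      rowDifference r x b - rowDifference r x 0
        ≡⟨ cong (rowDifference r x b -_) (rowDifference-first x x<n) ⟩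
      rowDifference r x b - 0ℤ
        ≡⟨ ℤP.+-identityʳ _ ⟩
      rowDifference r x b ∎
      where open ≡-Reasoning

  corner-ofRank : ∀ a b → a ≤ n → b ≤ n → corner (ofRank {n} r) a b ≡ r a b
  corner-ofRank a b a≤n b≤n = begin
    corner (ofRank {n} r) a b
      ≡⟨ sumBelow-cong a (λ x x<a → rowPrefix-ofRank x b (ℕP.<-≤-trans x<a a≤n) b≤n) ⟩
    sumBelow (λ x → r (suc x) b - r x b) a
      ≡⟨ sumBelow-telescope (λ x → r x b) a ⟩
    r a b - r 0 b
      ≡⟨ cong (r a b -_) (top b b≤n) ⟩
    r a b - 0ℤ
      ≡⟨ ℤP.+-identityʳ _ ⟩
    r a b ∎
    where open ≡-Reasoning

-- Strong order and joins

_≤ᶜ_ : ∀ {n} → Matrix n → Matrix n → Set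
_≤ᶜ_ {n} P Q = ∀ a b → a ≤ n → b ≤ n → corner Q a b ≤ℤ corner P a b

≤ₛ⇒≤ᶜ : ∀ {n} {P Q : Matrix n} → P ≤ₛ Q → P ≤ᶜ Q
≤ₛ⇒≤ᶜ             P≤Q zero    _       _   _   = ℤP.≤-refl
≤ₛ⇒≤ᶜ {P = P} {Q} P≤Q (suc a) zero    _   _   =
  ℤP.≤-reflexive (trans (corner-zeroʳ Q (suc a)) (sym (corner-zeroʳ P (suc a))))
≤ₛ⇒≤ᶜ {P = P} {Q} P≤Q (suc a) (suc b) a<n b<n =
  subst₂ _≤ℤ_ (rk-fromℕ< Q a<n b<n) (rk-fromℕ< P a<n b<n) (P≤Q (fromℕ< a<n) (fromℕ< b<n))

≤ᶜ⇒≤ₛ : ∀ {n} {P Q : Matrix n} → P ≤ᶜ Q → P ≤ₛ Q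
≤ᶜ⇒≤ₛ {P = P} {Q} P≤Q i j =
  subst₂ _≤ℤ_ (sym (rk≡corner Q i j)) (sym (rk≡corner P i j)) (P≤Q _ _ (FinP.toℕ<n i) (FinP.toℕ<n j))

+1-distrib-⊓ : ∀ x y → (x ⊓ y) + 1ℤ ≡ (x + 1ℤ) ⊓ (y + 1ℤ)
+1-distrib-⊓ = ℤP.mono-≤-distrib-⊓ (ℤP.+-monoˡ-≤ 1ℤ)

unitStep-+1 : ∀ {x y} → UnitStep x y → UnitStep (x + 1ℤ) (y + 1ℤ)
unitStep-+1 (x≤y , y≤x+1) = ℤP.+-monoˡ-≤ 1ℤ x≤y , ℤP.+-monoˡ-≤ 1ℤ y≤x+1

unitStep-⊓ : ∀ {x x′ y y′} → UnitStep x x′ → UnitStep y y′ → UnitStep (x ⊓ y) (x′ ⊓ y′)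
unitStep-⊓ {x} {x′} {y} {y′} (x≤x′ , x′≤x+1) (y≤y′ , y′≤y+1) =
  ℤP.⊓-mono-≤ x≤x′ y≤y′ ,
  ℤP.≤-trans (ℤP.⊓-mono-≤ x′≤x+1 y′≤y+1) (ℤP.≤-reflexive (sym (+1-distrib-⊓ x y)))

minimum : ∀ {k} → (Fin (suc k) → ℤ) → ℤ
minimum {zero}  f = f Fin.zero
minimum {suc k} f = f Fin.zero ⊓ minimum (f ∘ Fin.suc)

minimum-≤ : ∀ {k} (f : Fin (suc k) → ℤ) t → minimum f ≤ℤ f t
minimum-≤ {zero}  f Fin.zero    = ℤP.≤-refl
minimum-≤ {suc k} f Fin.zero    = ℤP.i⊓j≤i _ _
minimum-≤ {suc k} f (Fin.suc t) = ℤP.≤-trans (ℤP.i⊓j≤j _ _) (minimum-≤ (f ∘ Fin.suc) t)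

≤-minimum : ∀ {k} {c} (f : Fin (suc k) → ℤ) → (∀ t → c ≤ℤ f t) → c ≤ℤ minimum f
≤-minimum {zero}  f c≤f = c≤f Fin.zero
≤-minimum {suc k} f c≤f = ℤP.⊓-glb (c≤f Fin.zero) (≤-minimum (f ∘ Fin.suc) (c≤f ∘ Fin.suc))

minimum-cong : ∀ {k} {f g : Fin (suc k) → ℤ} → (∀ t → f t ≡ g t) → minimum f ≡ minimum g
minimum-cong {zero}  f≗g = f≗g Fin.zero
minimum-cong {suc k} f≗g = cong₂ _⊓_ (f≗g Fin.zero) (minimum-cong (f≗g ∘ Fin.suc))

minimum-const : ∀ {k} {f : Fin (suc k) → ℤ} {v} → (∀ t → f t ≡ v) → minimum f ≡ v
minimum-const {zero}  f≡v = f≡v Fin.zero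
minimum-const {suc k} f≡v = trans (cong₂ _⊓_ (f≡v Fin.zero) (minimum-const (f≡v ∘ Fin.suc))) (ℤP.⊓-idem _)

minimum-distrib-⊓ : ∀ {k} (f g : Fin (suc k) → ℤ) → minimum (λ t → f t ⊓ g t) ≡ minimum f ⊓ minimum g
minimum-distrib-⊓ {zero}  f g = refl
minimum-distrib-⊓ {suc k} f g =
  trans (cong (λ m → (f Fin.zero ⊓ g Fin.zero) ⊓ m) (minimum-distrib-⊓ (f ∘ Fin.suc) (g ∘ Fin.suc)))
        (interchange (f Fin.zero) (g Fin.zero) (minimum (f ∘ Fin.suc)) (minimum (g ∘ Fin.suc)))
  where open CommSemigroupProperties ℤP.⊓-commutativeSemigroup using (interchange)

minimum-+1 : ∀ {k} (f : Fin (suc k) → ℤ) → minimum (λ t → f t + 1ℤ) ≡ minimum f + 1ℤ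
minimum-+1 {zero}  f = refl
minimum-+1 {suc k} f =
  trans (cong (λ m → (f Fin.zero + 1ℤ) ⊓ m) (minimum-+1 (f ∘ Fin.suc)))
        (sym (+1-distrib-⊓ (f Fin.zero) (minimum (f ∘ Fin.suc))))

minimum-unitStep : ∀ {k} (f g : Fin (suc k) → ℤ) → (∀ t → UnitStep (f t) (g t)) →
                   UnitStep (minimum f) (minimum g)
minimum-unitStep {zero}  f g step = step Fin.zero
minimum-unitStep {suc k} f g step =
  unitStep-⊓ (step Fin.zero) (minimum-unitStep (f ∘ Fin.suc) (g ∘ Fin.suc) (step ∘ Fin.suc))

minimum-isRankFunction : ∀ {n k} {r : Fin (suc k) → ℕ → ℕ → ℤ} → (∀ t → IsRankFunction n (r t)) →
                         IsRankFunction n (λ a b → minimum (λ t → r t a b))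
minimum-isRankFunction rank = record
  { top    = λ b b≤n → minimum-const (λ t → top (rank t) b b≤n)
  ; left   = λ a a≤n → minimum-const (λ t → left (rank t) a a≤n)
  ; bottom = λ b b≤n → minimum-const (λ t → bottom (rank t) b b≤n)
  ; right  = λ a a≤n → minimum-const (λ t → right (rank t) a a≤n)
  ; down   = λ a b a<n b≤n → minimum-unitStep _ _ (λ t → down (rank t) a b a<n b≤n)
  ; across = λ a b a≤n b<n → minimum-unitStep _ _ (λ t → across (rank t) a b a≤n b<n)
  }
  where open IsRankFunction

CornerMinimum : ∀ {n k} → (Fin (suc k) → Matrix n) → Matrix n → Set
CornerMinimum {n} B J = ∀ a b → a ≤ n → b ≤ n → corner J a b ≡ minimum (λ t → corner (B t) a b)

join⇒cornerMinimum : ∀ {n k} {B : Fin (suc k) → Matrix n} {J : Matrix n} →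
                     (∀ t → IsASM (B t)) → IsJoin B J → CornerMinimum B J
join⇒cornerMinimum {n} {B = B} {J} asmB (_ , upper , least) a b a≤n b≤n =
  ℤP.≤-antisym (≤-minimum _ (λ t → ≤ₛ⇒≤ᶜ (upper t) a b a≤n b≤n))
               (subst (_≤ℤ corner J a b) (corner-C a b a≤n b≤n)
                      (≤ₛ⇒≤ᶜ (least C (ofRank-isASM rank) below) a b a≤n b≤n))
  where
  m : ℕ → ℕ → ℤ
  m a b = minimum (λ t → corner (B t) a b)
  rank : IsRankFunction n m
  rank = minimum-isRankFunction (λ t → corner-isRankFunction (asmB t))
  C : Matrix n
  C = ofRank m
  corner-C : ∀ a b → a ≤ n → b ≤ n → corner C a b ≡ m a b
  corner-C = corner-ofRank rank
  below : ∀ t → B t ≤ₛ C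
  below t = ≤ᶜ⇒≤ₛ (λ a b a≤n b≤n → subst (_≤ℤ corner (B t) a b) (sym (corner-C a b a≤n b≤n))
                                          (minimum-≤ (λ t → corner (B t) a b) t))

cornerMinimum⇒join : ∀ {n k} {B : Fin (suc k) → Matrix n} {J : Matrix n} →
                     IsASM J → CornerMinimum B J → IsJoin B J
cornerMinimum⇒join {B = B} {J} asmJ J≡min = asmJ , upper , least
  where
  upper : ∀ t → B t ≤ₛ J
  upper t = ≤ᶜ⇒≤ₛ (λ a b a≤n b≤n → subst (_≤ℤ corner (B t) a b) (sym (J≡min a b a≤n b≤n))
                                          (minimum-≤ (λ t → corner (B t) a b) t))
  least : ∀ C → IsASM C → (∀ t → B t ≤ₛ C) → J ≤ₛ C
  least C _ B≤C = ≤ᶜ⇒≤ₛ (λ a b a≤n b≤n → subst (corner C a b ≤ℤ_) (sym (J≡min a b a≤n b≤n))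
                                                 (≤-minimum _ (λ t → ≤ₛ⇒≤ᶜ (B≤C t) a b a≤n b≤n)))

-- The projection π_i

unitStep-capˡ : ∀ {x y w} → UnitStep x y → UnitStep y w → UnitStep x ((x + 1ℤ) ⊓ w)
unitStep-capˡ {x} (x≤y , _) (y≤w , _) = ℤP.⊓-glb (ℤP.i≤i+j x 1ℤ) (ℤP.≤-trans x≤y y≤w) , ℤP.i⊓j≤i _ _

unitStep-capʳ : ∀ {x y w} → UnitStep x y → UnitStep y w → UnitStep ((x + 1ℤ) ⊓ w) w
unitStep-capʳ {x} {y} {w} (_ , y≤x+1) (_ , w≤y+1) =
  ℤP.i⊓j≤j _ _ ,
  ℤP.≤-trans (ℤP.⊓-glb (ℤP.≤-trans w≤y+1 (ℤP.+-monoˡ-≤ 1ℤ y≤x+1)) (ℤP.i≤i+j w 1ℤ))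
             (ℤP.≤-reflexive (sym (+1-distrib-⊓ (x + 1ℤ) w)))

module RowRaise {n} (i : Fin n) (i+1<n : suc (toℕ i) < n) where

  p : ℕ
  p = suc (toℕ i)

  i<n : toℕ i < n
  i<n = FinP.toℕ<n i

  -- Row i of rk is row p of the grid.
  raise : (ℕ → ℕ → ℤ) → ℕ → ℕ → ℤ
  raise r a b with a ℕP.≟ p
  ... | yes _ = (r (toℕ i) b + 1ℤ) ⊓ r (suc p) b
  ... | no  _ = r a b

  raise-row : ∀ r b → raise r p b ≡ (r (toℕ i) b + 1ℤ) ⊓ r (suc p) b
  raise-row r b with p ℕP.≟ p
  ... | yes _   = refl
  ... | no  p≢p = contradiction refl p≢p

  raise-off : ∀ r {a} b → a ≢ p → raise r a b ≡ r a b
  raise-off r {a} b a≢p with a ℕP.≟ p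
  ... | yes a≡p = contradiction a≡p a≢p
  ... | no  _   = refl

  raise-isRankFunction : ∀ {r} → IsRankFunction n r → IsRankFunction n (raise r)
  raise-isRankFunction {r} rank = record
    { top    = λ b b≤n → trans (raise-off r b (λ ())) (top b b≤n)
    ; left   = left′
    ; bottom = λ b b≤n → trans (raise-off r b (λ n≡p → ℕP.<⇒≢ i+1<n (sym n≡p))) (bottom b b≤n)
    ; right  = right′
    ; down   = down′
    ; across = across′
    }
    where
    open IsRankFunction rank

    left′ : ∀ a → a ≤ n → raise r a 0 ≡ 0ℤ
    left′ a a≤n with a ℕP.≟ p
    ... | yes refl = cong₂ (λ x y → (x + 1ℤ) ⊓ y) (left (toℕ i) (ℕP.<⇒≤ i<n)) (left (suc p) i+1<n)
    ... | no  _    = left a a≤n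

    right′ : ∀ a → a ≤ n → raise r a n ≡ + a
    right′ a a≤n with a ℕP.≟ p
    ... | yes refl = begin
      (r (toℕ i) n + 1ℤ) ⊓ r (suc p) n
        ≡⟨ cong₂ (λ x y → (x + 1ℤ) ⊓ y) (right (toℕ i) (ℕP.<⇒≤ i<n)) (right (suc p) i+1<n) ⟩
      + (toℕ i ℕ.+ 1) ⊓ + suc p
        ≡⟨ cong (λ x → + x ⊓ + suc p) (ℕP.+-comm (toℕ i) 1) ⟩
      + p ⊓ + suc p
        ≡⟨ ℤP.i≤j⇒i⊓j≡i (ℤ.+≤+ (ℕP.n≤1+n p)) ⟩
      + p
        ∎
      where open ≡-Reasoning
    ... | no  _    = right a a≤n

    down′ : ∀ a b → a < n → b ≤ n → UnitStep (raise r a b) (raise r (suc a) b)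
    down′ a b a<n b≤n with a ℕP.≟ p | suc a ℕP.≟ p
    ... | yes refl | yes 1+p≡p = contradiction 1+p≡p (ℕP.1+n≢n)
    ... | yes refl | no  _     = unitStep-capʳ (down (toℕ i) b i<n b≤n) (down p b i+1<n b≤n)
    ... | no  _    | yes refl  = unitStep-capˡ (down (toℕ i) b i<n b≤n) (down p b i+1<n b≤n)
    ... | no  _    | no  _     = down a b a<n b≤n

    across′ : ∀ a b → a ≤ n → b < n → UnitStep (raise r a b) (raise r a (suc b))
    across′ a b a≤n b<n with a ℕP.≟ p
    ... | yes refl =
      unitStep-⊓ (unitStep-+1 (across (toℕ i) b (ℕP.<⇒≤ i<n) b<n)) (across (suc p) b i+1<n b<n)
    ... | no  _    = across a b a≤n b<n

  corner-offRow : ∀ {M P} → SameRkOffRow i M P →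
                  ∀ a b → a ≤ n → b ≤ n → a ≢ p → corner P a b ≡ corner M a b
  corner-offRow         _          zero    _       _   _   _     = refl
  corner-offRow {M} {P} _          (suc a) zero    _   _   _     =
    trans (corner-zeroʳ P (suc a)) (sym (corner-zeroʳ M (suc a)))
  corner-offRow {M} {P} (_ , same) (suc a) (suc b) a<n b<n 1+a≢p = begin
    corner P (suc a) (suc b)        ≡⟨ rk-fromℕ< P a<n b<n ⟨
    rk P (fromℕ< a<n) (fromℕ< b<n)  ≡⟨ same (fromℕ< a<n) a≢i (fromℕ< b<n) ⟩
    rk M (fromℕ< a<n) (fromℕ< b<n)  ≡⟨ rk-fromℕ< M a<n b<n ⟩
    corner M (suc a) (suc b)        ∎
    where
    open ≡-Reasoning
    a≢i : fromℕ< a<n ≢ i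
    a≢i a≡i = 1+a≢p (cong suc (trans (sym (FinP.toℕ-fromℕ< a<n)) (cong toℕ a≡i)))

  module _ {M : Matrix n} (asm : IsASM M) where
    private
      rank : IsRankFunction n (raise (corner M))
      rank = raise-isRankFunction (corner-isRankFunction asm)

    raised : Matrix n
    raised = ofRank (raise (corner M))

    corner-raised : ∀ a b → a ≤ n → b ≤ n → corner raised a b ≡ raise (corner M) a b
    corner-raised = corner-ofRank rank

    raised-sameRkOffRow : SameRkOffRow i M raised
    raised-sameRkOffRow = ofRank-isASM rank , λ a a≢i b → begin
      rk raised a b
        ≡⟨ rk≡corner raised a b ⟩
      corner raised (suc (toℕ a)) (suc (toℕ b))
        ≡⟨ corner-raised _ _ (FinP.toℕ<n a) (FinP.toℕ<n b) ⟩
      raise (corner M) (suc (toℕ a)) (suc (toℕ b))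
        ≡⟨ raise-off (corner M) _ (a≢i ∘ FinP.toℕ-injective ∘ ℕP.suc-injective) ⟩
      corner M (suc (toℕ a)) (suc (toℕ b))
        ≡⟨ rk≡corner M a b ⟨
      rk M a b
        ∎
      where open ≡-Reasoning

  corner-π : ∀ {M P} → IsASM M → IsPi i M P →
             ∀ a b → a ≤ n → b ≤ n → corner P a b ≡ raise (corner M) a b
  corner-π {M} {P} asm (sameP , least) a b a≤n b≤n with a ℕP.≟ p
  ... | no  a≢p  = corner-offRow sameP a b a≤n b≤n a≢p
  ... | yes refl = ℤP.≤-antisym upper lower
    where
    open IsRankFunction (corner-isRankFunction (proj₁ sameP))
    upper : corner P p b ≤ℤ (corner M (toℕ i) b + 1ℤ) ⊓ corner M (suc p) b
    upper = ℤP.⊓-glb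
      (ℤP.≤-trans (proj₂ (down (toℕ i) b i<n b≤n))
                  (ℤP.≤-reflexive (cong (_+ 1ℤ)
                    (corner-offRow sameP (toℕ i) b (ℕP.<⇒≤ i<n) b≤n (ℕP.1+n≢n ∘ sym)))))
      (ℤP.≤-trans (proj₁ (down p b i+1<n b≤n))
                  (ℤP.≤-reflexive (corner-offRow sameP (suc p) b i+1<n b≤n ℕP.1+n≢n)))
    lower : (corner M (toℕ i) b + 1ℤ) ⊓ corner M (suc p) b ≤ℤ corner P p b
    lower = subst (_≤ℤ corner P p b) (trans (corner-raised asm p b a≤n b≤n) (raise-row (corner M) b))
                  (≤ₛ⇒≤ᶜ (least (raised asm) (raised-sameRkOffRow asm)) p b a≤n b≤n)

  raise-minimum : ∀ {k} {m : ℕ → ℕ → ℤ} (r : Fin (suc k) → ℕ → ℕ → ℤ) →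
                  (∀ a b → a ≤ n → b ≤ n → m a b ≡ minimum (λ t → r t a b)) →
                  ∀ a b → a ≤ n → b ≤ n → raise m a b ≡ minimum (λ t → raise (r t) a b)
  raise-minimum {m = m} r m≡min a b a≤n b≤n with a ℕP.≟ p
  ... | no  _    = m≡min a b a≤n b≤n
  ... | yes refl = begin
    (m (toℕ i) b + 1ℤ) ⊓ m (suc p) b
      ≡⟨ cong₂ (λ x y → (x + 1ℤ) ⊓ y) (m≡min (toℕ i) b (ℕP.<⇒≤ i<n) b≤n)
                                      (m≡min (suc p) b i+1<n b≤n) ⟩
    (minimum (λ t → r t (toℕ i) b) + 1ℤ) ⊓ minimum (λ t → r t (suc p) b)
      ≡⟨ cong (_⊓ minimum (λ t → r t (suc p) b)) (minimum-+1 (λ t → r t (toℕ i) b)) ⟨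
    minimum (λ t → r t (toℕ i) b + 1ℤ) ⊓ minimum (λ t → r t (suc p) b)
      ≡⟨ minimum-distrib-⊓ (λ t → r t (toℕ i) b + 1ℤ) (λ t → r t (suc p) b) ⟨
    minimum (λ t → (r t (toℕ i) b + 1ℤ) ⊓ r t (suc p) b)
      ∎
    where open ≡-Reasoning

m<n∸1⇒1+m<n : ∀ {m n} → m < n ∸ 1 → suc m < n
m<n∸1⇒1+m<n {n = suc n} m<n-1 = s≤s m<n-1

proposition3p4 : (n k : ℕ) → 1 ≤ k →
    (A : Matrix n) (B : Fin k → Matrix n) →
    IsASM A → (∀ t → IsASM (B t)) →
    IsJoin B A →
    (i : Fin n) → toℕ i < n ∸ 1 →
    (PA : Matrix n) → IsPi i A PA →
    (PB : Fin k → Matrix n) → (∀ t → IsPi i (B t) (PB t)) →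
    IsJoin PB PA
proposition3p4 n (suc k) _ A B asmA asmB joinA i i<n-1 PA piA PB piB =
  cornerMinimum⇒join (proj₁ (proj₁ piA)) λ a b a≤n b≤n → begin
    corner PA a b
      ≡⟨ corner-π asmA piA a b a≤n b≤n ⟩
    raise (corner A) a b
      ≡⟨ raise-minimum (λ t → corner (B t)) (join⇒cornerMinimum asmB joinA) a b a≤n b≤n ⟩
    minimum (λ t → raise (corner (B t)) a b)
      ≡⟨ minimum-cong (λ t → corner-π (asmB t) (piB t) a b a≤n b≤n) ⟨
    minimum (λ t → corner (PB t) a b)
      ∎
  where
  open RowRaise i (m<n∸1⇒1+m<n i<n-1)
  open ≡-Reasoning
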